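{- Let $G$ be a graph with $m$ edges and $n$ vertices and let $t=\min\{m,\lceil \frac{n^2}{4}-\frac{n}{4}+\frac12\rceil\}$. Then $G$ is a $t$-interval-PCG.
   Context: All trees are unrooted with edges weighted by nonnegative real numbers; $d_T(u,v)$ is the sum of edge weights on the unique path between leaves $u,v$ of $T$. For $k\ge1$, a graph $G=(V,E)$ is a $k$-interval-PCG if there exist a tree $T$ with leaf set $V$ and $k$ pairwise disjoint intervals $I_1,\ldots,I_k$ of nonnegative real numbers such that $\{u,v\}\in E$ iff $d_T(u,v)\in I_j$ for some $j$. -}

module Defs where

open import Data.Nat as ℕ using (ℕ; _∸_; _⊓_)
open import Data.Nat.DivMod using (_/_)
open import Data.Fin using (Fin; toℕ)
open import Data.Fin.Properties using ()
open import Data.Bool using (Bool; true; false; T)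
open import Data.Bool.Properties using (T?)
open import Data.List using (List; []; _∷_; length; filter; allFin; cartesianProduct; head; last)
open import Data.List.Relation.Unary.Linked using (Linked)
open import Data.List.Relation.Unary.Unique.Propositional using (Unique)
open import Data.Maybe using (just)
open import Data.Product using (Σ; ∃; _×_; _,_; proj₁; proj₂)
open import Relation.Nullary using (¬_)
open import Relation.Nullary.Decidable using (_×-dec_)
open import Relation.Binary.PropositionalEquality using (_≡_; _≢_)
open import Data.Rational using (ℚ; 0ℚ; _+_; _≤_)
open import Function.Bundles using (_⇔_)

record SimpleGraph (n : ℕ) : Set where
  field
    adj    : Fin n → Fin n → Bool
    sym    : ∀ i j → adj i j ≡ adj j i
    irrefl : ∀ i → adj i i ≡ false
open SimpleGraph public

edgeCount : ∀ {n} → SimpleGraph n → ℕ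
edgeCount {n} G =
  length (filter (λ p → (toℕ (proj₁ p) ℕ.<? toℕ (proj₂ p)) ×-dec T? (adj G (proj₁ p) (proj₂ p)))
                 (cartesianProduct (allFin n) (allFin n)))

-- ⌈ n²/4 − n/4 + 1/2 ⌉ = ⌈ (n² − n + 2) / 4 ⌉ = ⌊ (n² − n + 5) / 4 ⌋
bound : ℕ → ℕ
bound n = (n ℕ.* n ∸ n ℕ.+ 5) / 4

tBound : ∀ {n} → SimpleGraph n → ℕ
tBound {n} G = edgeCount G ⊓ bound n

module _ {N : ℕ} (H : SimpleGraph N) where
  Adj : Fin N → Fin N → Set
  Adj x y = T (adj H x y)

  IsPath : List (Fin N) → Set
  IsPath ps = Linked Adj ps × Unique ps

  PathFromTo : Fin N → Fin N → List (Fin N) → Set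
  PathFromTo u v ps = IsPath ps × head ps ≡ just u × last ps ≡ just v

  degree : Fin N → ℕ
  degree x = length (filter (λ y → T? (adj H x y)) (allFin N))

pathWeight : ∀ {N} → (Fin N → Fin N → ℚ) → List (Fin N) → ℚ
pathWeight w []           = 0ℚ
pathWeight w (x ∷ [])     = 0ℚ
pathWeight w (x ∷ y ∷ ps) = w x y + pathWeight w (y ∷ ps)

record WTree (N : ℕ) : Set where
  field
    graph     : SimpleGraph N
    weight    : Fin N → Fin N → ℚ
    wsym      : ∀ x y → weight x y ≡ weight y x
    wnonneg   : ∀ x y → 0ℚ ≤ weight x y
    connected : ∀ x y → ∃ λ ps → PathFromTo graph x y ps
    acyclic   : ∀ ps → 3 ℕ.≤ length ps → ∀ u v → PathFromTo graph u v ps → ¬ Adj graph v u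
open WTree public

record Interval : Set₁ where
  field
    Mem      : ℚ → Set
    nonneg   : ∀ x → Mem x → 0ℚ ≤ x
    convex   : ∀ x y z → Mem x → Mem z → x ≤ y → y ≤ z → Mem y
    nonempty : ∃ Mem
open Interval public

-- T has leaf set V = Fin n, via the injective labelling ℓ whose image is
-- exactly the set of nodes of degree ≤ 1.
record LeafLabelling {N : ℕ} (T : WTree N) (n : ℕ) : Set where
  field
    ℓ      : Fin n → Fin N
    inj    : ∀ i j → ℓ i ≡ ℓ j → i ≡ j
    leaves : ∀ x → degree (graph T) x ℕ.≤ 1 → ∃ λ i → ℓ i ≡ x
    isLeaf : ∀ i → degree (graph T) (ℓ i) ℕ.≤ 1
open LeafLabelling public

-- d_T(u , v) ∈ I  (the path between u and v in a tree is unique)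
DistIn : ∀ {N} (T : WTree N) → Fin N → Fin N → Interval → Set
DistIn T u v I = ∃ λ ps → PathFromTo (graph T) u v ps × Mem I (pathWeight (weight T) ps)

IsIntervalPCG : ℕ → ∀ {n} → SimpleGraph n → Set₁
IsIntervalPCG k {n} G =
  Σ ℕ λ N → Σ (WTree N) λ Tr → Σ (LeafLabelling Tr n) λ L → Σ (Fin k → Interval) λ I →
    (∀ i j → i ≢ j → ∀ x → ¬ (Mem (I i) x × Mem (I j) x)) ×
    (∀ u v → u ≢ v →
       T (adj G u v) ⇔ ∃ λ j → DistIn Tr (ℓ L u) (ℓ L v) (I j))

-- Hang the n vertices as leaves on a star whose i-th edge has weight 2^(i+1), so that the
-- distance of a leaf pair {u, v} is 2^(u+1) + 2^(v+1): distinct pairs get distinct even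
-- distances.  If m ≤ ⌈n²/4 − n/4 + 1/2⌉, one point interval per edge distance works.
-- Otherwise take one interval below the smallest non-edge distance and one strictly between
-- each non-edge distance and the next; there are 1 + (n(n−1)/2 − m) of them, which is at most
-- the bound precisely because m exceeds it.  Either family is then padded to exactly t
-- intervals by points lying beyond every leaf distance.  For n ≤ 1 the centre of the star
-- would itself be a leaf, so there a tree with n nodes is used instead.

module Submission where

open import Defs hiding (sym)
open import Data.Nat
open import Data.Nat.Properties
open import Data.Product using (∃; _×_; _,_; proj₁; proj₂)
open import Data.Sum using (_⊎_; inj₁; inj₂; [_,_]′)
open import Data.Fin as F using (Fin; toℕ; zero; suc)
import Data.Fin.Properties as FP
open import Data.Empty using (⊥-elim)
open import Data.Bool using (Bool; true; false; T)
open import Data.Bool.Properties using (T?)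
open import Relation.Binary using (tri<; tri≈; tri>)
open import Relation.Binary.PropositionalEquality
open import Relation.Nullary using (¬_; yes; no; does; contradiction)
import Data.Integer as ℤ
import Data.Integer.Properties as ℤP
import Data.Rational as Q
open import Data.Rational using (ℚ; 0ℚ; ↥_)
import Data.Rational.Properties as QP
open import Data.Rational.Unnormalised using (*≡*)
import Data.Rational.Unnormalised.Properties as UP
open import Data.Rational.Literals using (fromℤ)
open import Data.Rational.Base using (*≤*; *<*)
open import Data.List using (List; []; _∷_; length; filter; map; cartesianProduct; allFin; tabulate; _++_; lookup)
open import Data.List.Properties using (length-++; filter-++; filter-accept; filter-reject)
open import Data.Nat.ListAction using (sum)
open import Data.Nat.DivMod using (_/_; _%_; m≡m%n+[m/n]*n; m%n<n)
open import Data.Nat.Tactic.RingSolver using (solve-∀)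
open import Relation.Unary using (Pred; Decidable)
open import Relation.Unary.Properties using (_∩?_; ∁?)
open import Function.Base using (id)
open import Function.Bundles using (_⇔_; mk⇔; Equivalence)
open import Data.List.Membership.Propositional using (_∈_)
open import Data.List.Membership.Propositional.Properties using (∈-filter⁺; ∈-filter⁻; ∈-cartesianProduct⁺; ∈-allFin; ∈-lookup)
open import Data.List.Relation.Unary.Any using (here; there; index)
open import Data.List.Relation.Unary.Any.Properties using (lookup-index)
open import Data.List.Relation.Unary.All as All using ([]; _∷_)
open import Data.List.Relation.Unary.AllPairs using ([]; _∷_)
open import Data.List.Relation.Unary.Linked using ([-]; _∷_)
open import Data.Unit using (tt)
open import Data.Maybe.Properties using (just-injective)
open import Data.List.Relation.Unary.Unique.Propositional using (Unique)
import Data.List.Relation.Unary.Unique.Propositional.Properties as Unique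

ι : ℕ → ℚ
ι n = fromℤ (ℤ.+ n)

ι-+ : ∀ m n → ι m Q.+ ι n ≡ ι (m + n)
ι-+ m n = QP.toℚᵘ-injective (UP.≃-trans (QP.toℚᵘ-homo-+ (ι m) (ι n)) (*≡* numerators))
  where
  open ≡-Reasoning
  numerators : (ℤ.+ m ℤ.* ℤ.+ 1 ℤ.+ ℤ.+ n ℤ.* ℤ.+ 1) ℤ.* ℤ.+ 1 ≡ ℤ.+ (m + n) ℤ.* (ℤ.+ 1 ℤ.* ℤ.+ 1)
  numerators = begin
    (ℤ.+ m ℤ.* ℤ.+ 1 ℤ.+ ℤ.+ n ℤ.* ℤ.+ 1) ℤ.* ℤ.+ 1 ≡⟨ ℤP.*-identityʳ _ ⟩
    ℤ.+ m ℤ.* ℤ.+ 1 ℤ.+ ℤ.+ n ℤ.* ℤ.+ 1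
      ≡⟨ cong₂ ℤ._+_ (ℤP.*-identityʳ (ℤ.+ m)) (ℤP.*-identityʳ (ℤ.+ n)) ⟩
    ℤ.+ m ℤ.+ ℤ.+ n                                  ≡⟨ ℤP.pos-+ m n ⟨
    ℤ.+ (m + n)                                      ≡⟨ ℤP.*-identityʳ _ ⟨
    ℤ.+ (m + n) ℤ.* (ℤ.+ 1 ℤ.* ℤ.+ 1)                ∎

ι-injective : ∀ {m n} → ι m ≡ ι n → m ≡ n
ι-injective e = ℤP.+-injective (cong ↥_ e)

ι-mono-≤ : ∀ {m n} → m ≤ n → ι m Q.≤ ι n
ι-mono-≤ {m} {n} p = *≤* (subst₂ ℤ._≤_ (sym (ℤP.*-identityʳ (ℤ.+ m))) (sym (ℤP.*-identityʳ (ℤ.+ n))) (ℤ.+≤+ p))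

ι-cancel-≤ : ∀ {m n} → ι m Q.≤ ι n → m ≤ n
ι-cancel-≤ {m} {n} (*≤* p) = ℤP.drop‿+≤+ (subst₂ ℤ._≤_ (ℤP.*-identityʳ (ℤ.+ m)) (ℤP.*-identityʳ (ℤ.+ n)) p)

ι-mono-< : ∀ {m n} → m < n → ι m Q.< ι n
ι-mono-< {m} {n} p = *<* (subst₂ ℤ._<_ (sym (ℤP.*-identityʳ (ℤ.+ m))) (sym (ℤP.*-identityʳ (ℤ.+ n))) (ℤ.+<+ p))

ι-cancel-< : ∀ {m n} → ι m Q.< ι n → m < n
ι-cancel-< {m} {n} (*<* p) = ℤP.drop‿+<+ (subst₂ ℤ._<_ (ℤP.*-identityʳ (ℤ.+ m)) (ℤP.*-identityʳ (ℤ.+ n)) p)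

0≤ι : ∀ n → 0ℚ Q.≤ ι n
0≤ι n = ι-mono-≤ z≤n

1<2 : 1 < 2
1<2 = s≤s (s≤s z≤n)

2^-injective : ∀ {m n} → 2 ^ m ≡ 2 ^ n → m ≡ n
2^-injective {m} {n} e with <-cmp m n
... | tri< m<n _ _ = contradiction e (<⇒≢ (^-monoʳ-< 2 1<2 m<n))
... | tri≈ _ m≡n _ = m≡n
... | tri> _ _ n<m = contradiction (sym e) (<⇒≢ (^-monoʳ-< 2 1<2 n<m))

2^m+2^n<2^[1+n] : ∀ {m n} → m < n → 2 ^ m + 2 ^ n < 2 ^ suc n
2^m+2^n<2^[1+n] {m} {n} m<n = begin-strict
  2 ^ m + 2 ^ n <⟨ +-monoˡ-< (2 ^ n) (^-monoʳ-< 2 1<2 m<n) ⟩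
  2 ^ n + 2 ^ n ≡⟨ cong (2 ^ n +_) (+-identityʳ (2 ^ n)) ⟨
  2 ^ suc n     ∎
  where open ≤-Reasoning

2^m+2^n-injective : ∀ {m n p q} → m < n → p < q → 2 ^ m + 2 ^ n ≡ 2 ^ p + 2 ^ q → m ≡ p × n ≡ q
2^m+2^n-injective {m} {n} {p} {q} m<n p<q e with <-cmp n q
... | tri< n<q _ _ = contradiction e (<⇒≢ (<-≤-trans (2^m+2^n<2^[1+n] m<n)
                       (≤-trans (^-monoʳ-≤ 2 n<q) (m≤n+m (2 ^ q) (2 ^ p)))))
... | tri> _ _ q<n = contradiction (sym e) (<⇒≢ (<-≤-trans (2^m+2^n<2^[1+n] p<q)
                       (≤-trans (^-monoʳ-≤ 2 q<n) (m≤n+m (2 ^ n) (2 ^ m)))))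
... | tri≈ _ refl _ = 2^-injective (+-cancelʳ-≡ (2 ^ n) (2 ^ m) (2 ^ p) e) , refl

1+2*m<2*n : ∀ m n → 2 * m < 2 * n → suc (2 * m) < 2 * n
1+2*m<2*n m n lt = subst (_≤ 2 * n) (*-suc 2 m) (*-monoʳ-≤ 2 (*-cancelˡ-< 2 m n lt))

-- Even weights make distinct leaf distances differ by at least 2, so the open gap above a
-- distance always contains the next integer.
leafWeight : ℕ → ℕ
leafWeight k = 2 ^ suc k

code : ∀ {n} → Fin n → Fin n → ℕ
code a b = leafWeight (toℕ a) + leafWeight (toℕ b)

codeBound : ℕ → ℕ
codeBound n = 2 * (2 ^ n + 2 ^ n)

code-comm : ∀ {n} (a b : Fin n) → code a b ≡ code b a
code-comm a b = +-comm (leafWeight (toℕ a)) (leafWeight (toℕ b))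

code-injective : ∀ {n} {a b c d : Fin n} → toℕ a < toℕ b → toℕ c < toℕ d →
                 code a b ≡ code c d → a ≡ c × b ≡ d
code-injective a<b c<d e with 2^m+2^n-injective (s≤s a<b) (s≤s c<d) e
... | a≡c , b≡d = FP.toℕ-injective (suc-injective a≡c) , FP.toℕ-injective (suc-injective b≡d)

code-positive : ∀ {n} (a b : Fin n) → 0 < code a b
code-positive a b = <-≤-trans (m^n>0 2 (suc (toℕ a))) (m≤m+n _ _)

code-even : ∀ {n} (a b : Fin n) → code a b ≡ 2 * (2 ^ toℕ a + 2 ^ toℕ b)
code-even a b = sym (*-distribˡ-+ 2 (2 ^ toℕ a) (2 ^ toℕ b))

code-gap : ∀ {n} (a b c d : Fin n) → code a b < code c d → suc (code a b) < code c d
code-gap a b c d lt rewrite code-even a b | code-even c d = 1+2*m<2*n (2 ^ toℕ a + 2 ^ toℕ b) (2 ^ toℕ c + 2 ^ toℕ d) lt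

1+code<codeBound : ∀ {n} (a b : Fin n) → suc (code a b) < codeBound n
1+code<codeBound {n} a b rewrite code-even a b =
  1+2*m<2*n (2 ^ toℕ a + 2 ^ toℕ b) (2 ^ n + 2 ^ n)
    (*-monoʳ-< 2 (+-mono-<-≤ (^-monoʳ-< 2 1<2 (FP.toℕ<n a)) (^-monoʳ-≤ 2 (<⇒≤ (FP.toℕ<n b)))))

code≤codeBound : ∀ {n} (a b : Fin n) → ι (code a b) Q.≤ ι (codeBound n)
code≤codeBound a b = ι-mono-≤ (<⇒≤ (<-trans (n<1+n (code a b)) (1+code<codeBound a b)))

-- Ordered pairs of vertices

length-filter-∩?-∁? : ∀ {a p q} {A : Set a} {P : Pred A p} {Q : Pred A q} (P? : Decidable P) (Q? : Decidable Q) xs →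
  length (filter (P? ∩? Q?) xs) + length (filter (P? ∩? ∁? Q?) xs) ≡ length (filter P? xs)
length-filter-∩?-∁? P? Q? [] = refl
length-filter-∩?-∁? P? Q? (x ∷ xs) with P? x | Q? x
... | yes _ | yes _ = cong suc (length-filter-∩?-∁? P? Q? xs)
... | yes _ | no _  = trans (+-suc _ _) (cong suc (length-filter-∩?-∁? P? Q? xs))
... | no _  | yes _ = length-filter-∩?-∁? P? Q? xs
... | no _  | no _  = length-filter-∩?-∁? P? Q? xs

length-filter-map-, : ∀ {p} {A B : Set} {P : Pred (A × B) p} (P? : Decidable P) x (ys : List B) →
  length (filter P? (map (x ,_) ys)) ≡ length (filter (λ y → P? (x , y)) ys)
length-filter-map-, P? x [] = refl
length-filter-map-, P? x (y ∷ ys) with does (P? (x , y))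
... | true  = cong suc (length-filter-map-, P? x ys)
... | false = length-filter-map-, P? x ys

length-filter-cartesianProduct : ∀ {p} {A B : Set} {P : Pred (A × B) p} (P? : Decidable P) xs (ys : List B) →
  length (filter P? (cartesianProduct xs ys)) ≡ sum (map (λ x → length (filter (λ y → P? (x , y)) ys)) xs)
length-filter-cartesianProduct P? [] ys = refl
length-filter-cartesianProduct P? (x ∷ xs) ys = begin
  length (filter P? (map (x ,_) ys ++ cartesianProduct xs ys))
    ≡⟨ cong length (filter-++ P? (map (x ,_) ys) _) ⟩
  length (filter P? (map (x ,_) ys) ++ filter P? (cartesianProduct xs ys))
    ≡⟨ length-++ (filter P? (map (x ,_) ys)) ⟩
  length (filter P? (map (x ,_) ys)) + length (filter P? (cartesianProduct xs ys))
    ≡⟨ cong₂ _+_ (length-filter-map-, P? x ys) (length-filter-cartesianProduct P? xs ys) ⟩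
  sum (map (λ x → length (filter (λ y → P? (x , y)) ys)) (x ∷ xs)) ∎
  where open ≡-Reasoning

IsShift : ∀ {m n} → ℕ → (Fin m → Fin n) → Set
IsShift s f = ∀ i → toℕ (f i) ≡ s + toℕ i

IsShift-head : ∀ {m n s} {f : Fin (suc m) → Fin n} → IsShift s f → toℕ (f zero) ≡ s
IsShift-head {s = s} sh = trans (sh zero) (+-identityʳ s)

IsShift-tail : ∀ {m n s} {f : Fin (suc m) → Fin n} → IsShift s f → IsShift (suc s) (λ i → f (suc i))
IsShift-tail {s = s} sh i = trans (sh (suc i)) (+-suc s (toℕ i))

length-filter->-tabulate : ∀ {n} m k s (f : Fin m → Fin n) → IsShift s f →
  length (filter (λ y → k <? toℕ y) (tabulate f)) ≡ m ∸ (suc k ∸ s)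
length-filter->-tabulate zero k s f sh = sym (0∸n≡0 (suc k ∸ s))
length-filter->-tabulate (suc m) k s f sh with k <? toℕ (f zero)
... | yes k<f = begin
  length (filter (λ y → k <? toℕ y) (tabulate f))
    ≡⟨ cong length (filter-accept (λ y → k <? toℕ y) k<f) ⟩
  suc (length (filter (λ y → k <? toℕ y) (tabulate (λ i → f (suc i)))))
    ≡⟨ cong suc (length-filter->-tabulate m k (suc s) (λ i → f (suc i)) (IsShift-tail sh)) ⟩
  suc (m ∸ (suc k ∸ suc s)) ≡⟨ cong (λ z → suc (m ∸ z)) (m≤n⇒m∸n≡0 (<⇒≤ k<s)) ⟩
  suc m                     ≡⟨ cong (suc m ∸_) (m≤n⇒m∸n≡0 k<s) ⟨
  suc m ∸ (suc k ∸ s)       ∎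
  where
  open ≡-Reasoning
  k<s : k < s
  k<s = subst (k <_) (IsShift-head sh) k<f
... | no k≮f = begin
  length (filter (λ y → k <? toℕ y) (tabulate f))
    ≡⟨ cong length (filter-reject (λ y → k <? toℕ y) k≮f) ⟩
  length (filter (λ y → k <? toℕ y) (tabulate (λ i → f (suc i))))
    ≡⟨ length-filter->-tabulate m k (suc s) (λ i → f (suc i)) (IsShift-tail sh) ⟩
  m ∸ (k ∸ s)         ≡⟨ cong (suc m ∸_) (+-∸-assoc 1 s≤k) ⟨
  suc m ∸ (suc k ∸ s) ∎
  where
  open ≡-Reasoning
  s≤k : s ≤ k
  s≤k = subst (_≤ k) (IsShift-head sh) (≮⇒≥ k≮f)

greaterCount : ∀ {n} → Fin n → ℕ
greaterCount {n} x = length (filter (λ y → toℕ x <? toℕ y) (allFin n))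

greaterCount≡n∸[1+x] : ∀ {n} (x : Fin n) → greaterCount x ≡ n ∸ suc (toℕ x)
greaterCount≡n∸[1+x] {n} x = length-filter->-tabulate n (toℕ x) 0 id (λ _ → refl)

2*sum-greaterCount-tabulate : ∀ {n} m s (f : Fin m → Fin n) → s + m ≡ n → IsShift s f →
  2 * sum (map greaterCount (tabulate f)) + m ≡ m * m
2*sum-greaterCount-tabulate zero s f s+m≡n sh = refl
2*sum-greaterCount-tabulate {n} (suc m) s f s+1+m≡n sh = begin
  2 * (greaterCount (f zero) + S) + suc m ≡⟨ cong (λ c → 2 * (c + S) + suc m) head-count ⟩
  2 * (m + S) + suc m                     ≡⟨ regroup m S ⟩
  suc (m + m + (2 * S + m))               ≡⟨ cong (λ z → suc (m + m + z)) tail-sum ⟩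
  suc (m + m + m * m)                     ≡⟨ square-suc m ⟨
  suc m * suc m                           ∎
  where
  open ≡-Reasoning
  S = sum (map greaterCount (tabulate (λ i → f (suc i))))
  regroup : ∀ m S → 2 * (m + S) + suc m ≡ suc (m + m + (2 * S + m))
  regroup = solve-∀
  square-suc : ∀ m → suc m * suc m ≡ suc (m + m + m * m)
  square-suc = solve-∀
  tail-sum : 2 * S + m ≡ m * m
  tail-sum = 2*sum-greaterCount-tabulate m (suc s) (λ i → f (suc i))
               (trans (sym (+-suc s m)) s+1+m≡n) (IsShift-tail sh)
  head-count : greaterCount (f zero) ≡ m
  head-count = begin
    greaterCount (f zero)  ≡⟨ greaterCount≡n∸[1+x] (f zero) ⟩
    n ∸ suc (toℕ (f zero)) ≡⟨ cong₂ (λ a b → a ∸ suc b) (sym s+1+m≡n) (IsShift-head sh) ⟩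
    s + suc m ∸ suc s      ≡⟨ cong (_∸ suc s) (+-suc s m) ⟩
    suc s + m ∸ suc s      ≡⟨ m+n∸m≡n (suc s) m ⟩
    m                      ∎

Ordered : ∀ {n} → Pred (Fin n × Fin n) _
Ordered p = toℕ (proj₁ p) < toℕ (proj₂ p)

ordered? : ∀ {n} → Decidable (Ordered {n})
ordered? p = toℕ (proj₁ p) <? toℕ (proj₂ p)

allPairs : ∀ n → List (Fin n × Fin n)
allPairs n = cartesianProduct (allFin n) (allFin n)

orderedPairs : ∀ n → List (Fin n × Fin n)
orderedPairs n = filter ordered? (allPairs n)

2*|orderedPairs|+n≡n*n : ∀ n → 2 * length (orderedPairs n) + n ≡ n * n
2*|orderedPairs|+n≡n*n n = trans
  (cong (λ z → 2 * z + n) (length-filter-cartesianProduct ordered? (allFin n) (allFin n)))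
  (2*sum-greaterCount-tabulate n 0 id refl (λ _ → refl))

lookup-injective : ∀ {A : Set} {xs : List A} → Unique xs → ∀ i j → lookup xs i ≡ lookup xs j → i ≡ j
lookup-injective (_ ∷ _)       zero    zero    _ = refl
lookup-injective (x∉xs ∷ _)    zero    (suc j) e = contradiction e (All.lookup x∉xs (∈-lookup j))
lookup-injective (x∉xs ∷ _)    (suc i) zero    e = contradiction (sym e) (All.lookup x∉xs (∈-lookup i))
lookup-injective (_ ∷ unique) (suc i) (suc j) e = cong suc (lookup-injective unique i j e)

module _ {A : Set} (f : A → ℕ) where
  IsMaxBelow : List A → ℕ → A → Set
  IsMaxBelow xs e q = q ∈ xs × f q < e × (∀ q′ → q′ ∈ xs → f q′ < e → f q′ ≤ f q)

  none-below⊎max-below : ∀ xs e → (∀ q → q ∈ xs → e ≤ f q) ⊎ ∃ (IsMaxBelow xs e)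
  none-below⊎max-below []       e = inj₁ (λ _ ())
  none-below⊎max-below (x ∷ xs) e with f x <? e | none-below⊎max-below xs e
  ... | no x≮e | inj₁ none = inj₁ λ { q (here refl) → ≮⇒≥ x≮e ; q (there q∈) → none q q∈ }
  ... | no x≮e | inj₂ (q , q∈ , q<e , max) = inj₂ (q , there q∈ , q<e ,
        λ { q′ (here refl) x<e → contradiction x<e x≮e ; q′ (there q′∈) → max q′ q′∈ })
  ... | yes x<e | inj₁ none = inj₂ (x , here refl , x<e ,
        λ { q′ (here refl) _ → ≤-refl ; q′ (there q′∈) q′<e → contradiction (none q′ q′∈) (<⇒≱ q′<e) })
  ... | yes x<e | inj₂ (q , q∈ , q<e , max) with f x ≤? f q
  ...   | yes x≤q = inj₂ (q , there q∈ , q<e , λ { q′ (here refl) _ → x≤q ; q′ (there q′∈) → max q′ q′∈ })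
  ...   | no x≰q  = inj₂ (x , here refl , x<e ,
          λ { q′ (here refl) _ → ≤-refl
            ; q′ (there q′∈) q′<e → ≤-trans (max q′ q′∈ q′<e) (<⇒≤ (≰⇒> x≰q)) })

pairCode : ∀ {n} → Fin n × Fin n → ℕ
pairCode p = code (proj₁ p) (proj₂ p)

Ordered-pairCode-injective : ∀ {n} {p q : Fin n × Fin n} → Ordered p → Ordered q → pairCode p ≡ pairCode q → p ≡ q
Ordered-pairCode-injective p-ord q-ord e with code-injective p-ord q-ord e
... | refl , refl = refl

ordered-representative : ∀ {n} (u v : Fin n) → u ≢ v → ∃ λ q → Ordered q × (q ≡ (u , v) ⊎ q ≡ (v , u))
ordered-representative u v u≢v with <-cmp (toℕ u) (toℕ v)
... | tri< u<v _ _ = (u , v) , u<v , inj₁ refl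
... | tri≈ _ u≡v _ = contradiction (FP.toℕ-injective u≡v) u≢v
... | tri> _ _ v<u = (v , u) , v<u , inj₂ refl

pairCode-cases : ∀ {n} {u v : Fin n} {q} → u ≢ v → Ordered q → pairCode q ≡ code u v → q ≡ (u , v) ⊎ q ≡ (v , u)
pairCode-cases {u = u} {v} u≢v q-ord e with ordered-representative u v u≢v
... | r , r-ord , inj₁ refl = inj₁ (Ordered-pairCode-injective q-ord r-ord e)
... | r , r-ord , inj₂ refl = inj₂ (Ordered-pairCode-injective q-ord r-ord (trans e (code-comm u v)))

∈-allPairs : ∀ {n} (p : Fin n × Fin n) → p ∈ allPairs n
∈-allPairs (a , b) = ∈-cartesianProduct⁺ (∈-allFin a) (∈-allFin b)

module _ {n p} {P : Pred (Fin n × Fin n) p} (P? : Decidable P) where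
  orderedPairsWith : List (Fin n × Fin n)
  orderedPairsWith = filter (ordered? ∩? P?) (allPairs n)

  ∈-orderedPairsWith⁺ : ∀ {q} → Ordered q → P q → q ∈ orderedPairsWith
  ∈-orderedPairsWith⁺ {q} q-ord Pq = ∈-filter⁺ (ordered? ∩? P?) (∈-allPairs q) (q-ord , Pq)

  ∈-orderedPairsWith⁻ : ∀ {q} → q ∈ orderedPairsWith → Ordered q × P q
  ∈-orderedPairsWith⁻ q∈ = proj₂ (∈-filter⁻ (ordered? ∩? P?) {xs = allPairs n} q∈)

  lookup-orderedPairsWith-injective : ∀ i j →
    pairCode (lookup orderedPairsWith i) ≡ pairCode (lookup orderedPairsWith j) → i ≡ j
  lookup-orderedPairsWith-injective i j e = lookup-injective
    (Unique.filter⁺ (ordered? ∩? P?) (Unique.cartesianProduct⁺ (Unique.allFin⁺ n) (Unique.allFin⁺ n))) i j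
    (Ordered-pairCode-injective (proj₁ (∈-orderedPairsWith⁻ (∈-lookup i)))
                                (proj₁ (∈-orderedPairsWith⁻ (∈-lookup j))) e)

-- Separating families of intervals

point : ℕ → Interval
point a = record
  { Mem      = λ x → x ≡ ι a
  ; nonneg   = λ x x≡a → subst (0ℚ Q.≤_) (sym x≡a) (0≤ι a)
  ; convex   = λ x y z x≡a z≡a x≤y y≤z →
                 QP.≤-antisym (subst (y Q.≤_) z≡a y≤z) (subst (Q._≤ y) x≡a x≤y)
  ; nonempty = ι a , refl
  }

Disjoint : ∀ {k} → (Fin k → Interval) → Set
Disjoint I = ∀ i j → i ≢ j → ∀ x → ¬ (Mem (I i) x × Mem (I j) x)

Disjoint-splitAt : ∀ {k r} {I : Fin k → Interval} {J : Fin r → Interval} →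
  Disjoint I → Disjoint J → (∀ i j x → ¬ (Mem (I i) x × Mem (J j) x)) →
  Disjoint (λ i → [ I , J ]′ (F.splitAt k i))
Disjoint-splitAt {k} {r} I-disj J-disj IJ-disj i j i≢j x
  with F.splitAt k i in split-i | F.splitAt k j in split-j
... | inj₁ a | inj₁ b = I-disj a b
  (λ { refl → i≢j (trans (sym (FP.splitAt⁻¹-↑ˡ split-i)) (FP.splitAt⁻¹-↑ˡ split-j)) }) x
... | inj₂ a | inj₂ b = J-disj a b
  (λ { refl → i≢j (trans (sym (FP.splitAt⁻¹-↑ʳ split-i)) (FP.splitAt⁻¹-↑ʳ split-j)) }) x
... | inj₁ a | inj₂ b = IJ-disj a b x
... | inj₂ a | inj₁ b = λ (in-a , in-b) → IJ-disj b a x (in-b , in-a)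

record SeparatingFamily {n} (G : SimpleGraph n) (k : ℕ) : Set₁ where
  field
    interval  : Fin k → Interval
    disjoint  : Disjoint interval
    separates : ∀ u v → u ≢ v → T (adj G u v) ⇔ ∃ λ j → Mem (interval j) (ι (code u v))
open SeparatingFamily

module _ {n} {G : SimpleGraph n} where
  Bounded : ∀ {k} → SeparatingFamily G k → Set
  Bounded F = ∀ j x → Mem (interval F j) x → x Q.≤ ι (codeBound n)

  beyond : ∀ {r} → Fin r → Interval
  beyond j = point (codeBound n + suc (toℕ j))

  ¬beyond : ∀ {r} (j : Fin r) x → x Q.≤ ι (codeBound n) → ¬ Mem (beyond j) x
  ¬beyond j x x≤B refl = 1+n≰n (≤-trans (m≤m+n (suc (codeBound n)) (toℕ j))
                           (≤-trans (≤-reflexive (sym (+-suc (codeBound n) (toℕ j)))) (ι-cancel-≤ x≤B)))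

  Disjoint-beyond : ∀ {r} → Disjoint (beyond {r})
  Disjoint-beyond i j i≢j x (refl , x≡j) =
    i≢j (FP.toℕ-injective (suc-injective (+-cancelˡ-≡ (codeBound n) _ _ (ι-injective x≡j))))

  pad : ∀ {k} (F : SeparatingFamily G k) → Bounded F → ∀ r → SeparatingFamily G (k + r)
  pad {k} F bounded r = record
    { interval  = I
    ; disjoint  = Disjoint-splitAt (disjoint F) Disjoint-beyond
                    (λ i j x (in-i , in-j) → ¬beyond j x (bounded i x in-i) in-j)
    ; separates = λ u v u≢v → mk⇔
        (λ uv → let (j , in-j) = Equivalence.to (separates F u v u≢v) uv in
                j F.↑ˡ r , subst (λ s → Mem ([ interval F , beyond ]′ s) (ι (code u v)))
                                 (sym (FP.splitAt-↑ˡ k j r)) in-j)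
        (λ (i , in-i) → Equivalence.from (separates F u v u≢v) (unpad i (code≤codeBound u v) in-i))
    }
    where
    I : Fin (k + r) → Interval
    I i = [ interval F , beyond ]′ (F.splitAt k i)
    unpad : ∀ i {x} → x Q.≤ ι (codeBound n) → Mem (I i) x → ∃ λ j → Mem (interval F j) x
    unpad i {x} x≤B with F.splitAt k i
    ... | inj₁ j = λ in-j → j , in-j
    ... | inj₂ j = λ in-j → contradiction in-j (¬beyond j x x≤B)

padTo : ∀ {n k t} {G : SimpleGraph n} (F : SeparatingFamily G k) → Bounded F → k ≤ t → SeparatingFamily G t
padTo {G = G} F bounded k≤t = subst (SeparatingFamily G) (m+[n∸m]≡n k≤t) (pad F bounded _)

2*p+2≤4*bound : ∀ n p → 2 * p + n ≡ n * n → 2 * p + 2 ≤ 4 * bound n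
2*p+2≤4*bound n p 2p+n≡n² = +-cancelˡ-≤ 3 (2 * p + 2) (4 * bound n) (begin
  3 + (2 * p + 2)         ≡⟨ trans (+-comm 3 (2 * p + 2)) (+-assoc (2 * p) 2 3) ⟩
  2 * p + 5               ≡⟨ cong (_+ 5) 2p≡n²∸n ⟨
  a                       ≡⟨ m≡m%n+[m/n]*n a 4 ⟩
  a % 4 + (a / 4) * 4     ≤⟨ +-monoˡ-≤ ((a / 4) * 4) (<⇒≤pred (m%n<n a 4)) ⟩
  3 + (a / 4) * 4         ≡⟨ cong (3 +_) (*-comm (a / 4) 4) ⟩
  3 + 4 * bound n         ∎)
  where
  open ≤-Reasoning
  a = n * n ∸ n + 5
  2p≡n²∸n : n * n ∸ n ≡ 2 * p
  2p≡n²∸n = trans (cong (_∸ n) (sym 2p+n≡n²)) (m+n∸n≡m (2 * p) n)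

module _ {n} (G : SimpleGraph n) where
  Adjacent : Pred (Fin n × Fin n) _
  Adjacent p = T (adj G (proj₁ p) (proj₂ p))

  adjacent? : Decidable Adjacent
  adjacent? p = T? (adj G (proj₁ p) (proj₂ p))

  Adjacent-cases : ∀ {u v q} → q ≡ (u , v) ⊎ q ≡ (v , u) → Adjacent q ≡ T (adj G u v)
  Adjacent-cases (inj₁ refl)          = refl
  Adjacent-cases {u} {v} (inj₂ refl) = cong T (SimpleGraph.sym G v u)

  Adjacent-pairCode : ∀ {u v q} → u ≢ v → Ordered q → pairCode q ≡ code u v → Adjacent q ≡ T (adj G u v)
  Adjacent-pairCode u≢v q-ord e = Adjacent-cases (pairCode-cases u≢v q-ord e)

  ordered-pair-with-code : ∀ u v → u ≢ v → ∃ λ q → Ordered q × pairCode q ≡ code u v × Adjacent q ≡ T (adj G u v)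
  ordered-pair-with-code u v u≢v with ordered-representative u v u≢v
  ... | q , q-ord , q≡ = q , q-ord , [ (λ { refl → refl }) , (λ { refl → code-comm v u }) ]′ q≡ , Adjacent-cases q≡

  edges nonEdges : List (Fin n × Fin n)
  edges    = orderedPairsWith adjacent?
  nonEdges = orderedPairsWith (∁? adjacent?)

  bound<edgeCount⇒1+|nonEdges|≤bound : bound n < edgeCount G → suc (length nonEdges) ≤ bound n
  bound<edgeCount⇒1+|nonEdges|≤bound b<m with suc (length nonEdges) ≤? bound n
  ... | yes 1+k≤b = 1+k≤b
  ... | no 1+k≰b = contradiction (4*b<4*b) (<-irrefl refl)
    where
    open ≤-Reasoning
    m = edgeCount G
    k = length nonEdges
    p = length (orderedPairs n)
    4*b<4*b : 4 * bound n < 4 * bound n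
    4*b<4*b = begin-strict
      4 * bound n                 ≡⟨ *-distribʳ-+ (bound n) 2 2 ⟩
      2 * bound n + 2 * bound n   <⟨ +-mono-<-≤ (*-monoʳ-< 2 b<m) (*-monoʳ-≤ 2 (≮⇒≥ 1+k≰b)) ⟩
      2 * m + 2 * k               ≡⟨ *-distribˡ-+ 2 m k ⟨
      2 * (m + k)                 ≡⟨ cong (2 *_) (length-filter-∩?-∁? ordered? adjacent? (allPairs n)) ⟩
      2 * p                       ≤⟨ m≤m+n (2 * p) 2 ⟩
      2 * p + 2                   ≤⟨ 2*p+2≤4*bound n p (2*|orderedPairs|+n≡n*n n) ⟩
      4 * bound n                 ∎

  pointFamily : SeparatingFamily G (edgeCount G)
  pointFamily = record
    { interval  = λ j → point (pairCode (lookup edges j))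
    ; disjoint  = λ i j i≢j x (x≡i , x≡j) →
                    i≢j (lookup-orderedPairsWith-injective adjacent? i j (ι-injective (trans (sym x≡i) x≡j)))
    ; separates = λ u v u≢v → mk⇔ (edge⇒point u v u≢v) (point⇒edge u v u≢v)
    }
    where
    edge⇒point : ∀ u v → u ≢ v → T (adj G u v) → ∃ λ j → ι (code u v) ≡ ι (pairCode (lookup edges j))
    edge⇒point u v u≢v uv with ordered-pair-with-code u v u≢v
    ... | q , q-ord , q-code , q-adj =
      index q∈ , cong ι (trans (sym q-code) (cong pairCode (lookup-index q∈)))
      where q∈ = ∈-orderedPairsWith⁺ adjacent? q-ord (subst id (sym q-adj) uv)
    point⇒edge : ∀ u v → u ≢ v → (∃ λ j → ι (code u v) ≡ ι (pairCode (lookup edges j))) → T (adj G u v)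
    point⇒edge u v u≢v (j , e) with ∈-orderedPairsWith⁻ adjacent? (∈-lookup j)
    ... | q-ord , q-adj = subst id (Adjacent-pairCode u≢v q-ord (sym (ι-injective e))) q-adj

  pointFamily-bounded : Bounded pointFamily
  pointFamily-bounded j x refl = code≤codeBound (proj₁ (lookup edges j)) (proj₂ (lookup edges j))

  edge-code≢nonEdge-code : ∀ {u v q} → u ≢ v → T (adj G u v) → q ∈ nonEdges → pairCode q ≢ code u v
  edge-code≢nonEdge-code u≢v uv q∈ e with ∈-orderedPairsWith⁻ (∁? adjacent?) q∈
  ... | q-ord , ¬q-adj = ¬q-adj (subst id (sym (Adjacent-pairCode u≢v q-ord e)) uv)

  nonEdge-with-code : ∀ u v → u ≢ v → ¬ T (adj G u v) → ∃ λ q → q ∈ nonEdges × pairCode q ≡ code u v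
  nonEdge-with-code u v u≢v ¬uv with ordered-pair-with-code u v u≢v
  ... | q , q-ord , q-code , q-adj =
    q , ∈-orderedPairsWith⁺ (∁? adjacent?) q-ord (λ adj-q → ¬uv (subst id q-adj adj-q)) , q-code

  below : Interval
  below = record
    { Mem      = λ x → 0ℚ Q.≤ x × (∀ q → q ∈ nonEdges → x Q.< ι (pairCode q)) × x Q.≤ ι (codeBound n)
    ; nonneg   = λ x in-x → proj₁ in-x
    ; convex   = λ x y z (0≤x , _ , _) (_ , z<codes , z≤B) x≤y y≤z →
                   QP.≤-trans 0≤x x≤y , (λ q q∈ → QP.≤-<-trans y≤z (z<codes q q∈)) , QP.≤-trans y≤z z≤B
    ; nonempty = 0ℚ , QP.≤-refl , (λ q _ → ι-mono-< (code-positive (proj₁ q) (proj₂ q))) , 0≤ι (codeBound n)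
    }

  above : Fin n × Fin n → Interval
  above q = record
    { Mem      = λ x → ι (pairCode q) Q.< x
                     × (∀ q′ → q′ ∈ nonEdges → pairCode q < pairCode q′ → x Q.< ι (pairCode q′))
                     × x Q.≤ ι (codeBound n)
    ; nonneg   = λ x in-x → QP.≤-trans (0≤ι (pairCode q)) (QP.<⇒≤ (proj₁ in-x))
    ; convex   = λ x y z (q<x , _ , _) (_ , z<codes , z≤B) x≤y y≤z →
                   QP.<-≤-trans q<x x≤y , (λ q′ q′∈ q<q′ → QP.≤-<-trans y≤z (z<codes q′ q′∈ q<q′)) ,
                   QP.≤-trans y≤z z≤B
    ; nonempty = ι (suc (pairCode q)) , ι-mono-< (n<1+n (pairCode q)) ,
                 (λ q′ _ q<q′ → ι-mono-< (code-gap (proj₁ q) (proj₂ q) (proj₁ q′) (proj₂ q′) q<q′)) ,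
                 ι-mono-≤ (<⇒≤ (1+code<codeBound (proj₁ q) (proj₂ q)))
    }

  gap : Fin (suc (length nonEdges)) → Interval
  gap zero    = below
  gap (suc k) = above (lookup nonEdges k)

  gap-bounded : ∀ j x → Mem (gap j) x → x Q.≤ ι (codeBound n)
  gap-bounded zero    x (_ , _ , x≤B) = x≤B
  gap-bounded (suc k) x (_ , _ , x≤B) = x≤B

  nonEdge∉gap : ∀ j {q} → q ∈ nonEdges → ¬ Mem (gap j) (ι (pairCode q))
  nonEdge∉gap zero    q∈ (_ , <codes , _)  = QP.<-irrefl refl (<codes _ q∈)
  nonEdge∉gap (suc k) q∈ (k<q , <codes , _) = QP.<-irrefl refl (<codes _ q∈ (ι-cancel-< k<q))

  Disjoint-gap : Disjoint gap
  Disjoint-gap zero    zero    0≢0 _ _ = 0≢0 refl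
  Disjoint-gap zero    (suc k) _ x ((_ , <codes , _) , (k<x , _)) =
    QP.<-asym (<codes (lookup nonEdges k) (∈-lookup k)) k<x
  Disjoint-gap (suc k) zero    _ x ((k<x , _) , (_ , <codes , _)) =
    QP.<-asym (<codes (lookup nonEdges k) (∈-lookup k)) k<x
  Disjoint-gap (suc i) (suc j) i≢j x ((i<x , <codes-i , _) , (j<x , <codes-j , _))
    with <-cmp (pairCode (lookup nonEdges i)) (pairCode (lookup nonEdges j))
  ... | tri< i<j _ _ = QP.<-asym (<codes-i (lookup nonEdges j) (∈-lookup j) i<j) j<x
  ... | tri> _ _ j<i = QP.<-asym (<codes-j (lookup nonEdges i) (∈-lookup i) j<i) i<x
  ... | tri≈ _ i≡j _ = i≢j (cong suc (lookup-orderedPairsWith-injective (∁? adjacent?) i j i≡j))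

  edge∈gap : ∀ u v → u ≢ v → T (adj G u v) → ∃ λ j → Mem (gap j) (ι (code u v))
  edge∈gap u v u≢v uv with none-below⊎max-below pairCode nonEdges (code u v)
  ... | inj₁ none =
    zero , 0≤ι (code u v) , (λ q q∈ → ι-mono-< (≤∧≢⇒< (none q q∈) (≢-sym (edge-code≢nonEdge-code u≢v uv q∈)))) ,
    code≤codeBound u v
  ... | inj₂ (q , q∈ , q<e , max) =
    suc (index q∈) ,
    subst (λ r → Mem (above r) (ι (code u v))) (lookup-index q∈)
      (ι-mono-< q<e ,
       (λ q′ q′∈ q<q′ → ι-mono-< (≤∧≢⇒< (≮⇒≥ (λ q′<e → <⇒≱ q<q′ (max q′ q′∈ q′<e)))
                                        (≢-sym (edge-code≢nonEdge-code u≢v uv q′∈)))) ,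
       code≤codeBound u v)

  gap⇒edge : ∀ u v → u ≢ v → (∃ λ j → Mem (gap j) (ι (code u v))) → T (adj G u v)
  gap⇒edge u v u≢v (j , in-j) with T? (adj G u v)
  ... | yes uv = uv
  ... | no ¬uv with nonEdge-with-code u v u≢v ¬uv
  ...   | q , q∈ , q-code = ⊥-elim (nonEdge∉gap j q∈ (subst (λ c → Mem (gap j) (ι c)) (sym q-code) in-j))

  gapFamily : SeparatingFamily G (suc (length nonEdges))
  gapFamily = record
    { interval  = gap
    ; disjoint  = Disjoint-gap
    ; separates = λ u v u≢v → mk⇔ (edge∈gap u v u≢v) (gap⇒edge u v u≢v)
    }

-- The star tree

module Star (n : ℕ) where
  starAdj : Fin (suc n) → Fin (suc n) → Bool
  starAdj zero    zero    = false
  starAdj zero    (suc _) = true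
  starAdj (suc _) zero    = true
  starAdj (suc _) (suc _) = false

  starAdj-sym : ∀ x y → starAdj x y ≡ starAdj y x
  starAdj-sym zero    zero    = refl
  starAdj-sym zero    (suc _) = refl
  starAdj-sym (suc _) zero    = refl
  starAdj-sym (suc _) (suc _) = refl

  starAdj-irrefl : ∀ x → starAdj x x ≡ false
  starAdj-irrefl zero    = refl
  starAdj-irrefl (suc _) = refl

  starGraph : SimpleGraph (suc n)
  starGraph = record { adj = starAdj ; sym = starAdj-sym ; irrefl = starAdj-irrefl }

  starWeight : Fin (suc n) → Fin (suc n) → ℚ
  starWeight zero    (suc j) = ι (leafWeight (toℕ j))
  starWeight (suc i) zero    = ι (leafWeight (toℕ i))
  starWeight _       _       = 0ℚ

  starWeight-sym : ∀ x y → starWeight x y ≡ starWeight y x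
  starWeight-sym zero    zero    = refl
  starWeight-sym zero    (suc _) = refl
  starWeight-sym (suc _) zero    = refl
  starWeight-sym (suc _) (suc _) = refl

  starWeight-nonneg : ∀ x y → 0ℚ Q.≤ starWeight x y
  starWeight-nonneg zero    zero    = QP.≤-refl
  starWeight-nonneg zero    (suc j) = 0≤ι _
  starWeight-nonneg (suc i) zero    = 0≤ι _
  starWeight-nonneg (suc _) (suc _) = QP.≤-refl

  leafPath : Fin n → Fin n → List (Fin (suc n))
  leafPath u v = suc u ∷ zero ∷ suc v ∷ []

  leafPath-PathFromTo : ∀ {u v} → u ≢ v → PathFromTo starGraph (suc u) (suc v) (leafPath u v)
  leafPath-PathFromTo u≢v =
    (tt ∷ tt ∷ [-] , ((λ ()) ∷ (λ e → u≢v (FP.suc-injective e)) ∷ []) ∷ ((λ ()) ∷ []) ∷ [] ∷ []) ,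
    refl , refl

  star-connected : ∀ x y → ∃ λ ps → PathFromTo starGraph x y ps
  star-connected zero    zero    = zero ∷ [] , ([-] , [] ∷ []) , refl , refl
  star-connected zero    (suc j) = zero ∷ suc j ∷ [] , (tt ∷ [-] , ((λ ()) ∷ []) ∷ [] ∷ []) , refl , refl
  star-connected (suc i) zero    = suc i ∷ zero ∷ [] , (tt ∷ [-] , ((λ ()) ∷ []) ∷ [] ∷ []) , refl , refl
  star-connected (suc i) (suc j) with i F.≟ j
  ... | yes refl = suc i ∷ [] , ([-] , [] ∷ []) , refl , refl
  ... | no i≢j   = leafPath i j , leafPath-PathFromTo i≢j

  star-acyclic : ∀ ps → 3 ≤ length ps → ∀ x y → PathFromTo starGraph x y ps → ¬ Adj starGraph y x
  star-acyclic (zero ∷ zero ∷ _ ∷ _)                  (s≤s (s≤s (s≤s _))) _ _ ((() ∷ _ , _) , _)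
  star-acyclic (zero ∷ suc _ ∷ zero ∷ _)              (s≤s (s≤s (s≤s _))) _ _ ((_ , (_ ∷ 0≢0 ∷ _) ∷ _) , _) =
    ⊥-elim (0≢0 refl)
  star-acyclic (zero ∷ suc _ ∷ suc _ ∷ _)             (s≤s (s≤s (s≤s _))) _ _ ((_ ∷ () ∷ _ , _) , _)
  star-acyclic (suc _ ∷ suc _ ∷ _ ∷ _)                (s≤s (s≤s (s≤s _))) _ _ ((() ∷ _ , _) , _)
  star-acyclic (suc _ ∷ zero ∷ zero ∷ _)              (s≤s (s≤s (s≤s _))) _ _ ((_ ∷ () ∷ _ , _) , _)
  star-acyclic (suc _ ∷ zero ∷ suc _ ∷ [])            (s≤s (s≤s (s≤s _))) _ _ (_ , refl , refl) ()
  star-acyclic (suc _ ∷ zero ∷ suc _ ∷ suc _ ∷ _)     (s≤s (s≤s (s≤s _))) _ _ ((_ ∷ _ ∷ () ∷ _ , _) , _)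
  star-acyclic (suc _ ∷ zero ∷ suc _ ∷ zero ∷ _)      (s≤s (s≤s (s≤s _))) _ _ ((_ , _ ∷ (_ ∷ 0≢0 ∷ _) ∷ _) , _) =
    ⊥-elim (0≢0 refl)

  star : WTree (suc n)
  star = record
    { graph = starGraph ; weight = starWeight ; wsym = starWeight-sym ; wnonneg = starWeight-nonneg
    ; connected = star-connected ; acyclic = star-acyclic }

  degree-centre : degree starGraph zero ≡ n
  degree-centre = count n (λ i → i)
    where
    count : ∀ k (g : Fin k → Fin n) → length (filter (λ y → T? (starAdj zero y)) (tabulate (λ i → suc (g i)))) ≡ k
    count zero    g = refl
    count (suc k) g = cong suc (count k (λ i → g (suc i)))

  degree-leaf : ∀ a → degree starGraph (suc a) ≡ 1
  degree-leaf a = cong suc (count n (λ i → i))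
    where
    count : ∀ k (g : Fin k → Fin n) → length (filter (λ y → T? (starAdj (suc a) y)) (tabulate (λ i → suc (g i)))) ≡ 0
    count zero    g = refl
    count (suc k) g = count k (λ i → g (suc i))

  starLeaves : 2 ≤ n → LeafLabelling star n
  starLeaves 2≤n = record
    { ℓ      = suc
    ; inj    = λ _ _ → FP.suc-injective
    ; leaves = λ { zero deg≤1 → contradiction (subst (_≤ 1) degree-centre deg≤1) (<⇒≱ 2≤n)
                 ; (suc i) _ → i , refl }
    ; isLeaf = λ i → ≤-reflexive (degree-leaf i)
    }

  PathFromTo-leaves : ∀ {u v} ps → u ≢ v → PathFromTo starGraph (suc u) (suc v) ps → ps ≡ leafPath u v
  PathFromTo-leaves (_ ∷ [])                  u≢v (_ , refl , e) = ⊥-elim (u≢v (FP.suc-injective (just-injective e)))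
  PathFromTo-leaves (_ ∷ suc _ ∷ _)           _   ((() ∷ _ , _) , refl , _)
  PathFromTo-leaves (_ ∷ zero ∷ [])           _   (_ , refl , ())
  PathFromTo-leaves (_ ∷ zero ∷ zero ∷ _)     _   ((_ ∷ () ∷ _ , _) , refl , _)
  PathFromTo-leaves (_ ∷ zero ∷ suc _ ∷ [])   _   (_ , refl , e) with FP.suc-injective (just-injective e)
  ... | refl = refl
  PathFromTo-leaves (_ ∷ zero ∷ suc _ ∷ suc _ ∷ _) _ ((_ ∷ _ ∷ () ∷ _ , _) , refl , _)
  PathFromTo-leaves (_ ∷ zero ∷ suc _ ∷ zero ∷ _)  _ ((_ , _ ∷ (_ ∷ 0≢0 ∷ _) ∷ _) , refl , _) = ⊥-elim (0≢0 refl)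

  pathWeight-leafPath : ∀ u v → pathWeight starWeight (leafPath u v) ≡ ι (code u v)
  pathWeight-leafPath u v =
    trans (cong (ι (leafWeight (toℕ u)) Q.+_) (QP.+-identityʳ (ι (leafWeight (toℕ v)))))
          (ι-+ (leafWeight (toℕ u)) (leafWeight (toℕ v)))

  DistIn-star : ∀ {u v} → u ≢ v → ∀ I → DistIn star (suc u) (suc v) I ⇔ Mem I (ι (code u v))
  DistIn-star {u} {v} u≢v I = mk⇔
    (λ (ps , path , in-I) → subst (Mem I) (pathWeight-leafPath u v)
                              (subst (λ qs → Mem I (pathWeight starWeight qs)) (PathFromTo-leaves ps u≢v path) in-I))
    (λ in-I → leafPath u v , leafPath-PathFromTo u≢v , subst (Mem I) (sym (pathWeight-leafPath u v)) in-I)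

SeparatingFamily⇒IsIntervalPCG : ∀ {n k} {G : SimpleGraph n} → 2 ≤ n → SeparatingFamily G k → IsIntervalPCG k G
SeparatingFamily⇒IsIntervalPCG {n} 2≤n F =
  suc n , star , starLeaves 2≤n , interval F , disjoint F ,
  λ u v u≢v → mk⇔
    (λ uv → let (j , in-j) = Equivalence.to (separates F u v u≢v) uv in
            j , Equivalence.from (DistIn-star u≢v (interval F j)) in-j)
    (λ (j , dist-j) → Equivalence.from (separates F u v u≢v)
                        (j , Equivalence.to (DistIn-star u≢v (interval F j)) dist-j))
  where open Star n

separatingFamily-tBound : ∀ {n} (G : SimpleGraph n) → SeparatingFamily G (tBound G)
separatingFamily-tBound {n} G with edgeCount G ≤? bound n
... | yes m≤b = padTo (pointFamily G) (pointFamily-bounded G) (≤-reflexive (sym (m≤n⇒m⊓n≡m m≤b)))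
... | no m≰b  = padTo (gapFamily G) (gap-bounded G)
                  (subst (suc (length (nonEdges G)) ≤_) (sym (m≥n⇒m⊓n≡n (<⇒≤ b<m)))
                         (bound<edgeCount⇒1+|nonEdges|≤bound G b<m))
  where b<m = ≰⇒> m≰b

emptyTree : WTree 0
emptyTree = record
  { graph = record { adj = λ () ; sym = λ () ; irrefl = λ () } ; weight = λ ()
  ; wsym = λ () ; wnonneg = λ () ; connected = λ () ; acyclic = λ _ _ () }

emptyLeaves : LeafLabelling emptyTree 0
emptyLeaves = record { ℓ = λ () ; inj = λ () ; leaves = λ () ; isLeaf = λ () }

singletonGraph : SimpleGraph 1
singletonGraph = record { adj = λ _ _ → false ; sym = λ _ _ → refl ; irrefl = λ _ → refl }

singletonTree : WTree 1
singletonTree = record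
  { graph = singletonGraph ; weight = λ _ _ → 0ℚ ; wsym = λ _ _ → refl ; wnonneg = λ _ _ → QP.≤-refl
  ; connected = λ { zero zero → zero ∷ [] , ([-] , [] ∷ []) , refl , refl }
  ; acyclic = λ _ _ _ _ _ () }

singletonLeaves : LeafLabelling singletonTree 1
singletonLeaves = record { ℓ = id ; inj = λ _ _ → id ; leaves = λ x _ → x , refl ; isLeaf = λ _ → z≤n }

theorem3 : (n : ℕ) (G : SimpleGraph n) → IsIntervalPCG (tBound G) G
theorem3 zero          G = 0 , emptyTree , emptyLeaves , (λ ()) , (λ ()) , (λ ())
theorem3 (suc zero)    G = 1 , singletonTree , singletonLeaves , (λ ()) , (λ ()) ,
                           λ { zero zero 0≢0 → ⊥-elim (0≢0 refl) }
theorem3 (suc (suc n)) G = SeparatingFamily⇒IsIntervalPCG (s≤s (s≤s z≤n)) (separatingFamily-tBound G)
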